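{- (i) For every integer $\ell\ge 3$ with $\ell\neq 4$, the cyclic Kautz digraph $CK(3,\ell)$ has diameter $2\ell-1$; and for every integer $d\ge 3$, $CK(d,3)$ has diameter $2\cdot 3-1=5$. (ii) The cyclic Kautz digraph $CK(3,4)$ has diameter $6$.
   Context: $CK(d,\ell)$ is the digraph whose vertices are the words $x_1x_2\ldots x_\ell$ over $\mathbb{Z}_{d+1}$ with $x_i\neq x_{i+1}$ for $i=1,\dots,\ell-1$ and $x_\ell\neq x_1$, with arcs $x_1x_2\ldots x_\ell\to x_2\ldots x_\ell y$ for every $y\in\mathbb{Z}_{d+1}$ with $y\neq x_2,x_\ell$. The diameter is the maximum directed distance between ordered pairs of vertices. -}

module Defs where

open import Data.Nat using (ℕ; zero; suc; _∸_; _≤_)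
open import Data.Fin using (Fin; toℕ)
open import Data.Product using (Σ; ∃; _×_; _,_)
open import Relation.Binary.PropositionalEquality using (_≡_; _≢_)

-- A word x₁…x_ℓ over ℤ_{d+1} = Fin (suc d), written as a function Fin ℓ → Fin (suc d)
-- (position i ↦ x_{i+1}).
Word : ℕ → ℕ → Set
Word d ℓ = Fin ℓ → Fin (suc d)

IsCKWord : (d ℓ : ℕ) → Word d ℓ → Set
IsCKWord d ℓ x =
  (∀ (i j : Fin ℓ) → toℕ j ≡ suc (toℕ i) → x i ≢ x j) ×
  (∀ (i j : Fin ℓ) → toℕ i ≡ ℓ ∸ 1 → toℕ j ≡ 0 → x i ≢ x j)

CKVertex : ℕ → ℕ → Set
CKVertex d ℓ = Σ (Word d ℓ) (IsCKWord d ℓ)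

-- Arc x₁x₂…x_ℓ → x₂…x_ℓ y with y ≠ x₂ and y ≠ x_ℓ:
-- the target's positions 0..ℓ-2 are the source's positions 1..ℓ-1, and the
-- target's last letter y differs from the source's second letter and last letter.
CKArc : (d ℓ : ℕ) → CKVertex d ℓ → CKVertex d ℓ → Set
CKArc d ℓ (x , _) (z , _) =
  (∀ (i j : Fin ℓ) → toℕ j ≡ suc (toℕ i) → z i ≡ x j) ×
  (∀ (k s : Fin ℓ) → toℕ k ≡ ℓ ∸ 1 → toℕ s ≡ 1 → z k ≢ x s) ×
  (∀ (k : Fin ℓ) → toℕ k ≡ ℓ ∸ 1 → z k ≢ x k)

data Walk (d ℓ : ℕ) : CKVertex d ℓ → CKVertex d ℓ → ℕ → Set where
  here  : ∀ {u} → Walk d ℓ u u 0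
  step  : ∀ {u v w n} → CKArc d ℓ u v → Walk d ℓ v w n → Walk d ℓ u w (suc n)

DistLe : (d ℓ : ℕ) → CKVertex d ℓ → CKVertex d ℓ → ℕ → Set
DistLe d ℓ u v m = ∃ λ n → n ≤ m × Walk d ℓ u v n

-- CK(d,ℓ) has diameter D: every ordered pair is at distance ≤ D,
-- and some ordered pair is at distance exactly D (no shorter walk exists,
-- and one of length ≤ D does by the first clause).
HasDiameter : (d ℓ D : ℕ) → Set
HasDiameter d ℓ D =
  (∀ (u v : CKVertex d ℓ) → DistLe d ℓ u v D) ×
  (∃ λ (u : CKVertex d ℓ) → ∃ λ (v : CKVertex d ℓ) →
     ∀ (n : ℕ) → Walk d ℓ u v n → D ≤ n)

-- A walk of length n from u to v in CK(d, ℓ) is the same as a word of length n + ℓ that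
-- begins with u, ends with v, has distinct neighbouring letters, and has distinct letters at
-- distance ℓ − 1 among its first n + 1 positions.  For the upper bound, insert between u and v
-- a bridge of at most ℓ − 1 letters, chosen greedily from its end: each letter has to avoid
-- three letters, so four letters suffice, and the first one, which has four constraints, is
-- dealt with by a case distinction (for ℓ = 4 a finer one gives bridges of at most two letters).
-- For the lower bound we exhibit pairs over {0,1,2,3} between which every shorter word breaks
-- one of the conditions; in the hardest cases the letters after u are forced to alternate
-- between the two letters that are free at that point, until no letter is left.

module Submission where

open import Data.Empty using (⊥; ⊥-elim)
open import Data.Fin using (Fin; zero; suc; toℕ; fromℕ<; inject≤; #_)
import Data.Fin as Fin
open import Data.Fin.Properties using (toℕ-fromℕ<; fromℕ<-toℕ; toℕ<n; toℕ≤pred[n]; inject≤-injective; any?; pigeonhole)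
  renaming (_≟_ to _≟ᶠ_)
open import Data.Nat using (ℕ; zero; suc; _+_; _*_; _∸_; _≤_; _<_; z≤n; s≤s; z<s; _≤?_; _<?_)
open import Data.Nat.Tactic.RingSolver using (solve-∀)
open import Data.Sum using (_⊎_; inj₁; inj₂; [_,_]′)
open import Data.Nat.Properties
open import Data.Product using (∃; ∃₂; _×_; _,_; proj₁; proj₂)
open import Function using (_∘_)
open import Data.Vec using (_∷_; []; lookup)
open import Relation.Nullary using (¬_; Dec; yes; no; contradiction)
open import Relation.Nullary.Decidable using (¬?; _×-dec_)
open import Relation.Unary using (Decidable)
open import Relation.Binary.PropositionalEquality
open import Relation.Binary.Definitions using (tri<; tri≈; tri>)

open import Defs

≢-resp : ∀ {A : Set} {a a′ b b′ : A} → a ≡ a′ → b ≡ b′ → a′ ≢ b′ → a ≢ b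
≢-resp refl refl a′≢b′ = a′≢b′

-- Walks as words

module Words (d m : ℕ) where

  Letter : Set
  Letter = Fin (suc d)

  Vertex : Set
  Vertex = CKVertex d (suc m)

  -- Position p holds the letter x_{p+1}; positions past the word read as zero.
  letters : Vertex → ℕ → Letter
  letters (x , _) p with p <? suc m
  ... | yes p<ℓ = x (fromℕ< p<ℓ)
  ... | no _ = zero

  letters-< : ∀ u p (p<ℓ : p < suc m) → letters u p ≡ proj₁ u (fromℕ< p<ℓ)
  letters-< u p p<ℓ with p <? suc m
  ... | yes _ = refl
  ... | no p≮ℓ = ⊥-elim (p≮ℓ p<ℓ)

  letters-toℕ : ∀ u j → letters u (toℕ j) ≡ proj₁ u j
  letters-toℕ u j = trans (letters-< u (toℕ j) (toℕ<n j)) (cong (proj₁ u) (fromℕ<-toℕ j (toℕ<n j)))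

  letters-adjacent : ∀ u p → p < m → letters u p ≢ letters u (suc p)
  letters-adjacent u@(x , adjacent , _) p p<m eq =
    adjacent (fromℕ< p<ℓ) (fromℕ< (s≤s p<m))
      (trans (toℕ-fromℕ< (s≤s p<m)) (cong suc (sym (toℕ-fromℕ< p<ℓ))))
      (trans (sym (letters-< u p p<ℓ)) (trans eq (letters-< u (suc p) (s≤s p<m))))
    where
      p<ℓ : p < suc m
      p<ℓ = m≤n⇒m≤1+n p<m

  letters-cyclic : ∀ u → letters u 0 ≢ letters u m
  letters-cyclic u@(x , _ , cyclic) eq =
    cyclic (fromℕ< (n<1+n m)) zero (toℕ-fromℕ< (n<1+n m)) refl
      (sym (trans (sym (letters-< u 0 z<s)) (trans eq (letters-< u m (n<1+n m)))))

  vertex : (f : ℕ → Letter) → (∀ p → p < m → f p ≢ f (suc p)) → f 0 ≢ f m → Vertex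
  vertex f adjacent cyclic = (λ j → f (toℕ j)) , adjacent′ , cyclic′
    where
      adjacent′ : ∀ (a b : Fin (suc m)) → toℕ b ≡ suc (toℕ a) → f (toℕ a) ≢ f (toℕ b)
      adjacent′ a b b≡1+a eq =
        adjacent (toℕ a) (≤-pred (subst (_< suc m) b≡1+a (toℕ<n b))) (trans eq (cong f b≡1+a))
      cyclic′ : ∀ (a b : Fin (suc m)) → toℕ a ≡ m → toℕ b ≡ 0 → f (toℕ a) ≢ f (toℕ b)
      cyclic′ a b a≡m b≡0 eq = cyclic (sym (trans (cong f (sym a≡m)) (trans eq (cong f b≡0))))

  letters-vertex : ∀ f adjacent cyclic p → p ≤ m → letters (vertex f adjacent cyclic) p ≡ f p
  letters-vertex f adjacent cyclic p p≤m =
    trans (letters-< (vertex f adjacent cyclic) p (s≤s p≤m)) (cong f (toℕ-fromℕ< (s≤s p≤m)))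

  vertex⇒0<m : Vertex → 0 < m
  vertex⇒0<m u = n≢0⇒n>0 (λ m≡0 → letters-cyclic u (cong (letters u) (sym m≡0)))

  arc-shift : ∀ {u b} → CKArc d (suc m) u b → ∀ p → p < m → letters b p ≡ letters u (suc p)
  arc-shift {u} {b} (shift , _) p p<m = begin
    letters b p                        ≡⟨ letters-< b p (m≤n⇒m≤1+n p<m) ⟩
    proj₁ b (fromℕ< (m≤n⇒m≤1+n p<m))  ≡⟨ shift _ _ toℕ-next ⟩
    proj₁ u (fromℕ< (s≤s p<m))         ≡⟨ letters-< u (suc p) (s≤s p<m) ⟨
    letters u (suc p)                  ∎
    where
      open ≡-Reasoning
      toℕ-next : toℕ (fromℕ< (s≤s p<m)) ≡ suc (toℕ (fromℕ< (m≤n⇒m≤1+n p<m)))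
      toℕ-next = trans (toℕ-fromℕ< (s≤s p<m)) (cong suc (sym (toℕ-fromℕ< (m≤n⇒m≤1+n p<m))))

  -- The windows w[i..i+m], i ≤ n, form a walk: the condition x_ℓ ≠ x₁ on window i and the arc
  -- condition y ≠ x₂ on the arc into it are period≢, all others say neighbouring letters differ.
  record IsWalkWord (w : ℕ → Letter) (n : ℕ) : Set where
    field
      adjacent≢ : ∀ p → p < n + m → w p ≢ w (suc p)
      period≢   : ∀ p → p ≤ n → w p ≢ w (p + m)

  module _ {w : ℕ → Letter} {n : ℕ} (isWalkWord : IsWalkWord w n) where
    open IsWalkWord isWalkWord

    window : (i : ℕ) → i ≤ n → Vertex
    window i i≤n = vertex (λ p → w (i + p)) adjacent cyclic
      where
        adjacent : ∀ p → p < m → w (i + p) ≢ w (i + suc p)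
        adjacent p p<m eq = adjacent≢ (i + p) (+-mono-≤-< i≤n p<m) (trans eq (cong w (+-suc i p)))
        cyclic : w (i + 0) ≢ w (i + m)
        cyclic eq = period≢ i i≤n (trans (cong w (sym (+-identityʳ i))) eq)

    arc : ∀ i → i < n → (a b : Vertex) →
          (∀ j → proj₁ a j ≡ w (i + toℕ j)) → (∀ j → proj₁ b j ≡ w (suc i + toℕ j)) →
          CKArc d (suc m) a b
    arc i i<n (x , _) (z , _) x≈ z≈ = shift , new≢second , new≢last
      where
        open ≡-Reasoning
        shift : ∀ (a b : Fin (suc m)) → toℕ b ≡ suc (toℕ a) → z a ≡ x b
        shift a b b≡1+a = begin
          z a                  ≡⟨ z≈ a ⟩
          w (suc i + toℕ a)    ≡⟨ cong w (+-suc i (toℕ a)) ⟨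
          w (i + suc (toℕ a))  ≡⟨ cong (λ q → w (i + q)) b≡1+a ⟨
          w (i + toℕ b)        ≡⟨ x≈ b ⟨
          x b                  ∎
        new≢second : ∀ (k s : Fin (suc m)) → toℕ k ≡ m → toℕ s ≡ 1 → z k ≢ x s
        new≢second k s k≡m s≡1 eq = period≢ (suc i) i<n (begin
          w (suc i)          ≡⟨ cong w (trans (+-comm 1 i) (cong (i +_) (sym s≡1))) ⟩
          w (i + toℕ s)      ≡⟨ x≈ s ⟨
          x s                ≡⟨ eq ⟨
          z k                ≡⟨ z≈ k ⟩
          w (suc i + toℕ k)  ≡⟨ cong (λ q → w (suc i + q)) k≡m ⟩
          w (suc i + m)      ∎)
        new≢last : ∀ (k : Fin (suc m)) → toℕ k ≡ m → z k ≢ x k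
        new≢last k k≡m eq = adjacent≢ (i + m) (+-monoˡ-< m i<n) (begin
          w (i + m)          ≡⟨ cong (λ q → w (i + q)) k≡m ⟨
          w (i + toℕ k)      ≡⟨ x≈ k ⟨
          x k                ≡⟨ eq ⟨
          z k                ≡⟨ z≈ k ⟩
          w (suc i + toℕ k)  ≡⟨ cong (λ q → w (suc i + q)) k≡m ⟩
          w (suc i + m)      ∎)

    walk-from : (v : Vertex) → (∀ j → proj₁ v j ≡ w (n + toℕ j)) →
                ∀ i k → i + suc k ≡ n → (a : Vertex) → (∀ j → proj₁ a j ≡ w (i + toℕ j)) →
                Walk d (suc m) a v (suc k)
    walk-from v v≈ i zero i+1≡n a a≈ = step (arc i i<n a v a≈ v≈′) here
      where
        i<n : i < n
        i<n = subst (i <_) i+1≡n (m<m+n i z<s)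
        v≈′ : ∀ j → proj₁ v j ≡ w (suc i + toℕ j)
        v≈′ j = trans (v≈ j) (cong (λ q → w (q + toℕ j)) (trans (sym i+1≡n) (+-comm i 1)))
    walk-from v v≈ i (suc k) i+k+2≡n a a≈ =
      step (arc i i<n a next a≈ (λ _ → refl))
           (walk-from v v≈ (suc i) k (trans (sym (+-suc i (suc k))) i+k+2≡n) next (λ _ → refl))
      where
        i<n : i < n
        i<n = subst (i <_) i+k+2≡n (m<m+n i z<s)
        next : Vertex
        next = window (suc i) i<n

  record WalkWord (u v : Vertex) (n : ℕ) : Set where
    field
      word       : ℕ → Letter
      isWalkWord : IsWalkWord word n
      starts     : ∀ p → p ≤ m → word p ≡ letters u p
      ends       : ∀ p → p ≤ m → word (n + p) ≡ letters v p

  walkWord⇒walk : ∀ {u v n} → WalkWord u v (suc n) → Walk d (suc m) u v (suc n)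
  walkWord⇒walk {u} {v} {n} ww = walk-from isWalkWord v v≈ 0 n refl u u≈
    where
      open WalkWord ww
      u≈ : ∀ j → proj₁ u j ≡ word (toℕ j)
      u≈ j = sym (trans (starts (toℕ j) (toℕ≤pred[n] j)) (letters-toℕ u j))
      v≈ : ∀ j → proj₁ v j ≡ word (suc n + toℕ j)
      v≈ j = sym (trans (ends (toℕ j) (toℕ≤pred[n] j)) (letters-toℕ v j))

  trace : ∀ {u v n} → Walk d (suc m) u v n → ℕ → Letter
  trace {u} here = letters u
  trace {u} (step _ _) zero = letters u 0
  trace (step _ rest) (suc p) = trace rest p

  trace-starts : ∀ {u v n} (W : Walk d (suc m) u v n) → ∀ p → p ≤ m → trace W p ≡ letters u p
  trace-starts here p _ = refl
  trace-starts (step _ _) zero _ = refl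
  trace-starts {u} (step {v = b} a rest) (suc p) 1+p≤m =
    trans (trace-starts rest p (≤-trans (n≤1+n p) 1+p≤m)) (arc-shift {u} {b} a p 1+p≤m)

  trace-ends : ∀ {u v n} (W : Walk d (suc m) u v n) → ∀ p → trace W (n + p) ≡ letters v p
  trace-ends here p = refl
  trace-ends (step _ rest) p = trace-ends rest p

  trace-isWalkWord : ∀ {u v n} (W : Walk d (suc m) u v n) → IsWalkWord (trace W) n
  trace-isWalkWord W = record { adjacent≢ = adjacent W ; period≢ = period W }
    where
      adjacent : ∀ {u v n} (W : Walk d (suc m) u v n) → ∀ p → p < n + m → trace W p ≢ trace W (suc p)
      adjacent {u} here p p<m = letters-adjacent u p p<m
      adjacent {u} (step {v = b} a rest) zero _ eq =
        letters-adjacent u 0 (vertex⇒0<m u)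
          (trans eq (trans (trace-starts rest 0 z≤n) (arc-shift {u} {b} a 0 (vertex⇒0<m u))))
      adjacent (step a rest) (suc p) (s≤s p<n+m) = adjacent rest p p<n+m
      period : ∀ {u v n} (W : Walk d (suc m) u v n) → ∀ p → p ≤ n → trace W p ≢ trace W (p + m)
      period {u} here zero _ = letters-cyclic u
      period {u} W@(step _ _) zero _ eq =
        letters-cyclic u (trans (sym (trace-starts W 0 z≤n)) (trans eq (trace-starts W m ≤-refl)))
      period (step _ rest) (suc p) (s≤s p≤n) = period rest p p≤n

  walk⇒walkWord : ∀ {u v n} → Walk d (suc m) u v n → WalkWord u v n
  walk⇒walkWord W = record
    { word = trace W
    ; isWalkWord = trace-isWalkWord W
    ; starts = trace-starts W
    ; ends = λ p _ → trace-ends W p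
    }

  concat : (X Y Z : ℕ → Letter) (k : ℕ) → ℕ → Letter
  concat X Y Z k p with p ≤? m
  ... | yes _ = X p
  ... | no _ with p ∸ suc m <? k
  ...   | yes _ = Y (p ∸ suc m)
  ...   | no _ = Z (p ∸ suc m ∸ k)

  module _ (X Y Z : ℕ → Letter) (k : ℕ) where

    concat-X : ∀ p → p ≤ m → concat X Y Z k p ≡ X p
    concat-X p p≤m with p ≤? m
    ... | yes _ = refl
    ... | no p≰m = ⊥-elim (p≰m p≤m)

    concat-Y : ∀ t → t < k → concat X Y Z k (suc m + t) ≡ Y t
    concat-Y t t<k with suc m + t ≤? m
    ... | yes m+t<m = ⊥-elim (<⇒≱ (s≤s (m≤m+n m t)) m+t<m)
    ... | no _ with suc m + t ∸ suc m <? k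
    ...   | yes _ = cong Y (m+n∸m≡n (suc m) t)
    ...   | no t≮k = ⊥-elim (t≮k (subst (_< k) (sym (m+n∸m≡n (suc m) t)) t<k))

    private
      offset : ∀ j → suc m + k + j ∸ suc m ≡ k + j
      offset j = trans (cong (_∸ suc m) (+-assoc (suc m) k j)) (m+n∸m≡n (suc m) (k + j))

    concat-Z : ∀ j → concat X Y Z k (suc m + k + j) ≡ Z j
    concat-Z j with suc m + k + j ≤? m
    ... | yes m+k+j<m = ⊥-elim (<⇒≱ (s≤s (≤-trans (m≤m+n m k) (m≤m+n (m + k) j))) m+k+j<m)
    ... | no _ with suc m + k + j ∸ suc m <? k
    ...   | yes k+j<k = ⊥-elim (<⇒≱ k+j<k (subst (k ≤_) (sym (offset j)) (m≤m+n k j)))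
    ...   | no _ = cong Z (trans (cong (_∸ k) (offset j)) (m+n∸m≡n k j))

  data Block (k p : ℕ) : Set where
    in-X : p ≤ m → Block k p
    in-Y : ∀ t → t < k → p ≡ suc m + t → Block k p
    in-Z : ∀ j → p ≡ suc m + k + j → Block k p

  block : ∀ k p → Block k p
  block k p with p ≤? m
  ... | yes p≤m = in-X p≤m
  ... | no p≰m with p ∸ suc m <? k
  ...   | yes t<k = in-Y (p ∸ suc m) t<k (sym (m+[n∸m]≡n (≰⇒> p≰m)))
  ...   | no t≮k = in-Z (p ∸ suc m ∸ k) (begin
    p                                ≡⟨ m+[n∸m]≡n (≰⇒> p≰m) ⟨
    suc m + (p ∸ suc m)              ≡⟨ cong (suc m +_) (m+[n∸m]≡n (≮⇒≥ t≮k)) ⟨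
    suc m + (k + (p ∸ suc m ∸ k))    ≡⟨ +-assoc (suc m) k _ ⟨
    suc m + k + (p ∸ suc m ∸ k)      ∎)
    where open ≡-Reasoning

  -- The conditions on the word X[0..m] Y[0..k] Z[0..m] not already guaranteed by X and Z
  -- being the letters of vertices.
  record IsBridge (X Z : ℕ → Letter) (k : ℕ) (Y : ℕ → Letter) : Set where
    field
      enters    : X m ≢ Y 0
      adjacent  : ∀ t → t < k → Y t ≢ Y (suc t)
      leaves    : Y k ≢ Z 0
      period-XY : ∀ t → t ≤ k → X (suc t) ≢ Y t
      period-XZ : ∀ j → suc (suc k) + j ≤ m → X (suc (suc k) + j) ≢ Z j
      period-YZ : ∀ t j → t ≤ k → t + m ≡ suc k + j → Y t ≢ Z j

  module _ (u v : Vertex) {k : ℕ} {Y : ℕ → Letter} (k<m : k < m)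
           (bridge : IsBridge (letters u) (letters v) k Y) where
    open IsBridge bridge

    private
      X Z W : ℕ → Letter
      X = letters u
      Z = letters v
      W = concat X Y Z (suc k)

      W-X : ∀ p → p ≤ m → W p ≡ X p
      W-X = concat-X X Y Z (suc k)
      W-Y : ∀ t → t < suc k → W (suc m + t) ≡ Y t
      W-Y = concat-Y X Y Z (suc k)
      W-Z : ∀ j → W (suc m + suc k + j) ≡ Z j
      W-Z = concat-Z X Y Z (suc k)

    concat-adjacent : ∀ p → p < suc m + suc k + m → W p ≢ W (suc p)
    concat-adjacent p p<n+m with block (suc k) p
    ... | in-X p≤m with m≤n⇒m<n∨m≡n p≤m
    ...   | inj₁ p<m = ≢-resp (W-X p p≤m) (W-X (suc p) p<m)
                         (letters-adjacent u p p<m)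
    ...   | inj₂ refl = ≢-resp (W-X p p≤m)
                         (trans (cong W (sym (+-identityʳ (suc m)))) (W-Y 0 z<s)) enters
    concat-adjacent p _ | in-Y t t<1+k refl with m≤n⇒m<n∨m≡n (≤-pred t<1+k)
    ... | inj₁ t<k = ≢-resp (W-Y t t<1+k)
                       (trans (cong W (sym (+-suc (suc m) t))) (W-Y (suc t) (s≤s t<k)))
                       (adjacent t t<k)
    ... | inj₂ refl = ≢-resp (W-Y t t<1+k)
                        (trans (cong W (sym (trans (+-identityʳ (suc m + suc t)) (+-suc (suc m) t))))
                               (W-Z 0))
                        leaves
    concat-adjacent p p<n+m | in-Z j refl =
      ≢-resp (W-Z j)
        (trans (cong W (sym (+-suc (suc m + suc k) j))) (W-Z (suc j)))
        (letters-adjacent v j (+-cancelˡ-< (suc m + suc k) j m p<n+m))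

    concat-period : ∀ p → p ≤ suc m + suc k → W p ≢ W (p + m)
    concat-period p p≤n with block (suc k) p
    concat-period zero _ | in-X _ =
      ≢-resp (W-X 0 z≤n) (W-X m ≤-refl) (letters-cyclic u)
    concat-period (suc t) _ | in-X 1+t≤m with suc t ≤? suc k
    ... | yes 1+t≤1+k = ≢-resp (W-X (suc t) 1+t≤m)
                          (trans (cong W (trans (+-comm (suc t) m) (+-suc m t))) (W-Y t 1+t≤1+k))
                          (period-XY t (≤-pred 1+t≤1+k))
    ... | no 1+t≰1+k = ≢-resp (W-X (suc t) 1+t≤m)
                         (trans (cong W position) (W-Z j))
                         (≢-resp (cong X (sym t≡)) refl (period-XZ j (subst (_≤ m) (sym t≡) 1+t≤m)))
      where
        j : ℕ
        j = suc t ∸ suc (suc k)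
        t≡ : suc (suc k) + j ≡ suc t
        t≡ = m+[n∸m]≡n (≰⇒> 1+t≰1+k)
        position : suc t + m ≡ suc m + suc k + j
        position = trans (cong (_+ m) (sym t≡)) (rearrange k j m)
          where
            rearrange : ∀ a b c → suc (suc a) + b + c ≡ suc c + suc a + b
            rearrange = solve-∀
    concat-period p _ | in-Y t t<1+k refl =
      ≢-resp (W-Y t t<1+k) (trans (cong W position) (W-Z j))
        (period-YZ t j (≤-pred t<1+k) t+m≡)
      where
        j : ℕ
        j = t + m ∸ suc k
        t+m≡ : t + m ≡ suc k + j
        t+m≡ = sym (m+[n∸m]≡n (≤-trans k<m (m≤n+m m t)))
        position : suc m + t + m ≡ suc m + suc k + j
        position = trans (+-assoc (suc m) t m)
                     (trans (cong (suc m +_) t+m≡) (sym (+-assoc (suc m) (suc k) j)))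
    concat-period p p≤n | in-Z zero refl =
      ≢-resp (W-Z 0) (trans (cong W (+-assoc (suc m + suc k) 0 m)) (W-Z m))
        (letters-cyclic v)
    concat-period p p≤n | in-Z (suc j) refl =
      ⊥-elim (<⇒≱ (subst (_< suc m + suc k + suc j) (+-identityʳ _) (+-monoʳ-< (suc m + suc k) z<s)) p≤n)

    bridge⇒walk : Walk d (suc m) u v (suc m + suc k)
    bridge⇒walk = walkWord⇒walk record
      { word = W
      ; isWalkWord = record { adjacent≢ = concat-adjacent ; period≢ = concat-period }
      ; starts = W-X
      ; ends = λ p _ → W-Z p
      }

-- Short walks through bridges

Fresh : {A : Set} → A → A → A → A → Set
Fresh a b c y = y ≢ a × y ≢ b × y ≢ c

module _ {d : ℕ} (a b c : Fin (suc d)) where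

  fresh? : Decidable (Fresh a b c)
  fresh? y = ¬? (y ≟ᶠ a) ×-dec ¬? (y ≟ᶠ b) ×-dec ¬? (y ≟ᶠ c)

  stale-index : ∀ y → ¬ Fresh a b c y → ∃ λ i → y ≡ lookup (a ∷ b ∷ c ∷ []) i
  stale-index y stale with y ≟ᶠ a | y ≟ᶠ b | y ≟ᶠ c
  ... | yes y≡a | _       | _       = zero , y≡a
  ... | no _    | yes y≡b | _       = suc zero , y≡b
  ... | no _    | no _    | yes y≡c = suc (suc zero) , y≡c
  ... | no y≢a  | no y≢b  | no y≢c  = ⊥-elim (stale (y≢a , y≢b , y≢c))

  fresh-letter : 3 ≤ d → ∃ (Fresh a b c)
  fresh-letter 3≤d = among-candidates (any? (λ i → fresh? (candidate i)))
    where
      candidate : Fin 4 → Fin (suc d)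
      candidate i = inject≤ i (s≤s 3≤d)
      among-candidates : Dec (∃ λ i → Fresh a b c (candidate i)) → ∃ (Fresh a b c)
      among-candidates (yes (i , fresh)) = candidate i , fresh
      among-candidates (no none) = ⊥-elim (collision (pigeonhole (n<1+n 3) index))
        where
          index : Fin 4 → Fin 3
          index i = proj₁ (stale-index (candidate i) (λ fresh → none (i , fresh)))
          candidate≡ : ∀ i → candidate i ≡ lookup (a ∷ b ∷ c ∷ []) (index i)
          candidate≡ i = proj₂ (stale-index (candidate i) (λ fresh → none (i , fresh)))
          collision : (∃₂ λ i j → i Fin.< j × index i ≡ index j) → ⊥
          collision (i , j , i<j , same-index) =
            <-irrefl (cong toℕ (inject≤-injective _ _ i j same-candidate)) i<j
            where
              same-candidate : candidate i ≡ candidate j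
              same-candidate =
                trans (candidate≡ i) (trans (cong (lookup (a ∷ b ∷ c ∷ [])) same-index) (sym (candidate≡ j)))

m≡n+o⇒o≡m∸n : ∀ {m n o} → m ≡ n + o → o ≡ m ∸ n
m≡n+o⇒o≡m∸n {n = n} {o} m≡n+o = sym (trans (cong (_∸ n) m≡n+o) (m+n∸m≡n n o))

module Greedy {d m : ℕ} (pick : (a b c : Fin (suc d)) → ∃ (Fresh a b c))
              (X Z : ℕ → Fin (suc d)) (k : ℕ) where
  open Words d m

  -- The bridge Y 0 … Y k is chosen from the end: tail s is Y (k ∸ s), which must avoid three
  -- letters.  Its first letter y₀ is left to the caller.
  tail : ℕ → Letter
  tail zero    = proj₁ (pick (X (suc k)) (Z (m ∸ 1)) (Z 0))
  tail (suc s) = proj₁ (pick (X (k ∸ s)) (Z (m ∸ suc (suc s))) (tail s))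

  tail-zero-fresh : Fresh (X (suc k)) (Z (m ∸ 1)) (Z 0) (tail 0)
  tail-zero-fresh = proj₂ (pick (X (suc k)) (Z (m ∸ 1)) (Z 0))

  tail-suc-fresh : ∀ s → Fresh (X (k ∸ s)) (Z (m ∸ suc (suc s))) (tail s) (tail (suc s))
  tail-suc-fresh s = proj₂ (pick (X (k ∸ s)) (Z (m ∸ suc (suc s))) (tail s))

  bridge : Letter → ℕ → Letter
  bridge y₀ zero    = y₀
  bridge y₀ (suc t) = tail (k ∸ suc t)

  follower : ℕ → Letter
  follower zero    = Z 0
  follower (suc s) = tail s

  follower-pred : ∀ n → 0 < n → follower n ≡ tail (n ∸ 1)
  follower-pred (suc s) _ = refl

  bridge-tail : ∀ y₀ t s → suc t + s ≡ k → bridge y₀ (suc t) ≡ tail s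
  bridge-tail y₀ t s 1+t+s≡k = cong tail (sym (m≡n+o⇒o≡m∸n {k} {suc t} {s} (sym 1+t+s≡k)))

  tail-avoids : ∀ t s → suc t + s ≡ k →
                tail s ≢ X (suc (suc t)) × (∀ j → suc t + m ≡ suc k + j → tail s ≢ Z j)
  tail-avoids t zero t+1≡k =
    (λ eq → proj₁ tail-zero-fresh (trans eq (cong (λ q → X (suc q)) (trans (sym (+-identityʳ _)) t+1≡k)))) ,
    (λ j eq eq′ → proj₁ (proj₂ tail-zero-fresh) (trans eq′ (cong Z (j≡m∸1 j eq))))
    where
      j≡m∸1 : ∀ j → suc t + m ≡ suc k + j → j ≡ m ∸ 1
      j≡m∸1 j eq = m≡n+o⇒o≡m∸n (+-cancelˡ-≡ (suc t) _ _ (trans eq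
        (trans (cong (λ q → suc q + j) (sym (trans (sym (+-identityʳ _)) t+1≡k))) (sym (shuffle t j)))))
        where
          shuffle : ∀ a b → suc a + (1 + b) ≡ suc (suc a) + b
          shuffle = solve-∀
  tail-avoids t (suc s) t+s+2≡k =
    (λ eq → proj₁ (tail-suc-fresh s) (trans eq (cong X t+2≡k∸s))) ,
    (λ j eq eq′ → proj₁ (proj₂ (tail-suc-fresh s)) (trans eq′ (cong Z (j≡ j eq))))
    where
      t+2≡k∸s : suc (suc t) ≡ k ∸ s
      t+2≡k∸s = m≡n+o⇒o≡m∸n (trans (sym t+s+2≡k) (shuffle t s))
        where
          shuffle : ∀ a b → suc a + suc b ≡ b + suc (suc a)
          shuffle = solve-∀
      j≡ : ∀ j → suc t + m ≡ suc k + j → j ≡ m ∸ suc (suc s)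
      j≡ j eq = m≡n+o⇒o≡m∸n (+-cancelˡ-≡ (suc t) _ _
        (trans eq (trans (cong (λ q → suc q + j) (sym t+s+2≡k)) (shuffle t s j))))
        where
          shuffle : ∀ a b c → suc (suc a + suc b) + c ≡ suc a + (suc (suc b) + c)
          shuffle = solve-∀

  module _ (y₀ : Letter) (y₀-fresh : Fresh (X 1) (X m) (follower k) y₀)
           (≢Z : ∀ j → m ≡ suc k + j → y₀ ≢ Z j)
           (period-XZ : ∀ j → suc (suc k) + j ≤ m → X (suc (suc k) + j) ≢ Z j) where

    private
      Y : ℕ → Letter
      Y = bridge y₀

      ≢X₁ : y₀ ≢ X 1
      ≢X₁ = proj₁ y₀-fresh
      ≢Xₘ : y₀ ≢ X m
      ≢Xₘ = proj₁ (proj₂ y₀-fresh)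
      ≢follower : y₀ ≢ follower k
      ≢follower = proj₂ (proj₂ y₀-fresh)

    bridge-adjacent : ∀ t → t < k → Y t ≢ Y (suc t)
    bridge-adjacent zero 0<k eq = ≢follower (trans eq (sym (follower-pred k 0<k)))
    bridge-adjacent (suc t) 1+t<k eq = proj₂ (proj₂ (tail-suc-fresh s))
      (trans (sym (bridge-tail y₀ t (suc s) (trans (+-suc (suc t) s) t+2+s≡k)))
             (trans eq (bridge-tail y₀ (suc t) s t+2+s≡k)))
      where
        s : ℕ
        s = k ∸ suc (suc t)
        t+2+s≡k : suc (suc t) + s ≡ k
        t+2+s≡k = m+[n∸m]≡n 1+t<k

    bridge-leaves : ∀ n → n ≡ k → Y n ≢ Z 0
    bridge-leaves zero 0≡k = subst (λ q → y₀ ≢ follower q) (sym 0≡k) ≢follower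
    bridge-leaves (suc t) 1+t≡k eq =
      proj₂ (proj₂ tail-zero-fresh)
        (trans (sym (bridge-tail y₀ t 0 (trans (+-identityʳ _) 1+t≡k))) eq)

    bridge-period-XY : ∀ t → t ≤ k → X (suc t) ≢ Y t
    bridge-period-XY zero _ eq = ≢X₁ (sym eq)
    bridge-period-XY (suc t) 1+t≤k eq =
      proj₁ (tail-avoids t s t+1+s≡k) (trans (sym (bridge-tail y₀ t s t+1+s≡k)) (sym eq))
      where
        s : ℕ
        s = k ∸ suc t
        t+1+s≡k : suc t + s ≡ k
        t+1+s≡k = m+[n∸m]≡n 1+t≤k

    bridge-period-YZ : ∀ t j → t ≤ k → t + m ≡ suc k + j → Y t ≢ Z j
    bridge-period-YZ zero j _ m≡ = ≢Z j m≡
    bridge-period-YZ (suc t) j 1+t≤k t+m≡ eq =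
      proj₂ (tail-avoids t s t+1+s≡k) j t+m≡ (trans (sym (bridge-tail y₀ t s t+1+s≡k)) eq)
      where
        s : ℕ
        s = k ∸ suc t
        t+1+s≡k : suc t + s ≡ k
        t+1+s≡k = m+[n∸m]≡n 1+t≤k

    greedy-isBridge : IsBridge X Z k Y
    greedy-isBridge = record
      { enters    = λ eq → ≢Xₘ (sym eq)
      ; adjacent  = bridge-adjacent
      ; leaves    = bridge-leaves k refl
      ; period-XY = bridge-period-XY
      ; period-XZ = period-XZ
      ; period-YZ = bridge-period-YZ
      }

module _ {d m₂ : ℕ} (3≤d : 3 ≤ d) (u v : CKVertex d (3 + m₂)) where
  private
    m : ℕ
    m = 2 + m₂
  open Words d m

  private
    X Z : ℕ → Letter
    X = letters u
    Z = letters v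

    pick : (a b c : Letter) → ∃ (Fresh a b c)
    pick a b c = fresh-letter a b c 3≤d

    module G = Greedy {m = m} pick X Z

    walk-via : ∀ k → k < m → (y₀ : Letter) → Fresh (X 1) (X m) (G.follower k k) y₀ →
               (∀ j → m ≡ suc k + j → y₀ ≢ Z j) →
               (∀ j → suc (suc k) + j ≤ m → X (suc (suc k) + j) ≢ Z j) →
               Walk d (suc m) u v (suc m + suc k)
    walk-via k k<m y₀ fresh ≢Z period-XZ =
      bridge⇒walk u v k<m (G.greedy-isBridge k y₀ fresh ≢Z period-XZ)

    long-enough : suc m + m ≤ 2 * suc m ∸ 1
    long-enough = ≤-reflexive (identity m₂)
      where
        identity : ∀ a → suc (suc (suc a)) + suc (suc a) ≡ suc (suc a) + (suc (suc (suc a)) + 0)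
        identity = solve-∀

    no-room : ∀ j → suc m + j ≤ m → X (suc m + j) ≢ Z j
    no-room j m+j<m = ⊥-elim (<⇒≱ (s≤s (m≤m+n m j)) m+j<m)

    only-Z₀ : ∀ {y} → y ≢ Z 0 → ∀ j → m ≡ m + j → y ≢ Z j
    only-Z₀ y≢Z₀ j m≡m+j eq = y≢Z₀ (trans eq (cong Z (+-cancelˡ-≡ m j 0 (trans (sym m≡m+j) (sym (+-identityʳ m))))))

    only-Z₁ : ∀ {y} → y ≢ Z 1 → ∀ j → m ≡ suc m₂ + j → y ≢ Z j
    only-Z₁ y≢Z₁ j m≡ eq = y≢Z₁ (trans eq (cong Z (+-cancelˡ-≡ (suc m₂) j 1 (trans (sym m≡) (+-comm 1 (suc m₂))))))

    only-Xₘ-Z₀ : X m ≢ Z 0 → ∀ j → m + j ≤ m → X (m + j) ≢ Z j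
    only-Xₘ-Z₀ Xₘ≢Z₀ j m+j≤m eq =
      Xₘ≢Z₀ (trans (cong X (sym (trans (cong (m +_) j≡0) (+-identityʳ m)))) (trans eq (cong Z j≡0)))
      where
        j≡0 : j ≡ 0
        j≡0 = n≤0⇒n≡0 (+-cancelˡ-≤ m j 0 (≤-trans m+j≤m (≤-reflexive (sym (+-identityʳ m)))))

    -- The first letter of the bridge must avoid X 1, X m, its successor and the letter of v
    -- at distance m; each case below gets rid of one of these four constraints.
    via-second-letter : Z 1 ≢ X 1 → Z 1 ≢ X m → DistLe d (suc m) u v (2 * suc m ∸ 1)
    via-second-letter Z₁≢X₁ Z₁≢Xₘ = _ , long-enough ,
      walk-via (suc m₂) ≤-refl (Z 1) (Z₁≢X₁ , Z₁≢Xₘ , Z₁≢follower)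
        (only-Z₀ (λ eq → letters-adjacent v 0 z<s (sym eq))) no-room
      where
        Z₁≢follower : Z 1 ≢ G.follower (suc m₂) (suc m₂)
        Z₁≢follower eq = proj₂ (G.tail-avoids (suc m₂) 0 m₂ refl) 1 (+-comm 1 m) (sym eq)

    via-fresh-letter : X m ≡ Z 0 → DistLe d (suc m) u v (2 * suc m ∸ 1)
    via-fresh-letter Xₘ≡Z₀ with pick (X 1) (X m) (G.follower (suc m₂) (suc m₂))
    ... | y₀ , fresh@(_ , ≢Xₘ , _) = _ , long-enough ,
      walk-via (suc m₂) ≤-refl y₀ fresh (only-Z₀ (λ eq → ≢Xₘ (trans eq (sym Xₘ≡Z₀)))) no-room

    via-shorter-bridge : Z 1 ≡ X 1 ⊎ Z 1 ≡ X m → X m ≢ Z 0 → DistLe d (suc m) u v (2 * suc m ∸ 1)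
    via-shorter-bridge Z₁∈ Xₘ≢Z₀ with pick (X 1) (X m) (G.follower m₂ m₂)
    ... | y₀ , fresh@(≢X₁ , ≢Xₘ , _) = _ , ≤-trans (+-monoʳ-≤ (suc m) (n≤1+n (suc m₂))) long-enough ,
      walk-via m₂ (n≤1+n (suc m₂)) y₀ fresh
        (only-Z₁ (λ eq → [ (λ Z₁≡X₁ → ≢X₁ (trans eq Z₁≡X₁)) , (λ Z₁≡Xₘ → ≢Xₘ (trans eq Z₁≡Xₘ)) ]′ Z₁∈))
        (only-Xₘ-Z₀ Xₘ≢Z₀)

  dist≤2ℓ∸1 : DistLe d (3 + m₂) u v (2 * (3 + m₂) ∸ 1)
  dist≤2ℓ∸1 with Z 1 ≟ᶠ X 1 | Z 1 ≟ᶠ X m | X m ≟ᶠ Z 0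
  ... | _          | _          | yes Xₘ≡Z₀ = via-fresh-letter Xₘ≡Z₀
  ... | yes Z₁≡X₁  | _          | no Xₘ≢Z₀  = via-shorter-bridge (inj₁ Z₁≡X₁) Xₘ≢Z₀
  ... | no _       | yes Z₁≡Xₘ  | no Xₘ≢Z₀  = via-shorter-bridge (inj₂ Z₁≡Xₘ) Xₘ≢Z₀
  ... | no Z₁≢X₁   | no Z₁≢Xₘ   | no _       = via-second-letter Z₁≢X₁ Z₁≢Xₘ

all-dist≤2ℓ∸1 : ∀ {d} ℓ → 3 ≤ d → 3 ≤ ℓ → ∀ (u v : CKVertex d ℓ) → DistLe d ℓ u v (2 * ℓ ∸ 1)
all-dist≤2ℓ∸1 (suc (suc (suc m₂))) 3≤d (s≤s (s≤s (s≤s _))) u v = dist≤2ℓ∸1 3≤d u v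

Collision : {A : Set} → A → A → A → Set
Collision a b c = a ≡ b ⊎ a ≡ c ⊎ b ≡ c

module _ {d : ℕ} (3≤d : 3 ≤ d) where

  collision? : (a b c : Fin (suc d)) → Dec (Collision a b c)
  collision? a b c with a ≟ᶠ b | a ≟ᶠ c | b ≟ᶠ c
  ... | yes a≡b | _       | _       = yes (inj₁ a≡b)
  ... | no _    | yes a≡c | _       = yes (inj₂ (inj₁ a≡c))
  ... | no _    | no _    | yes b≡c = yes (inj₂ (inj₂ b≡c))
  ... | no a≢b  | no a≢c  | no b≢c  = no λ { (inj₁ a≡b) → a≢b a≡b
                                          ; (inj₂ (inj₁ a≡c)) → a≢c a≡c
                                          ; (inj₂ (inj₂ b≡c)) → b≢c b≡c }

  fresh-letter-beyond : ∀ {a b c} → Collision a b c → (e : Fin (suc d)) →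
                        ∃ λ y → Fresh a b c y × y ≢ e
  fresh-letter-beyond {a} {b} {c} (inj₁ refl) e with fresh-letter a c e 3≤d
  ... | y , y≢a , y≢c , y≢e = y , (y≢a , y≢a , y≢c) , y≢e
  fresh-letter-beyond {a} {b} {c} (inj₂ (inj₁ refl)) e with fresh-letter a b e 3≤d
  ... | y , y≢a , y≢b , y≢e = y , (y≢a , y≢b , y≢a) , y≢e
  fresh-letter-beyond {a} {b} {c} (inj₂ (inj₂ refl)) e with fresh-letter a b e 3≤d
  ... | y , y≢a , y≢b , y≢e = y , (y≢a , y≢b , y≢b) , y≢e

module _ (u v : CKVertex 3 4) where
  open Words 3 3

  private
    X Z : ℕ → Letter
    X = letters u
    Z = letters v

    walk-5 : (y : Letter) → y ≢ X 3 → y ≢ Z 0 → y ≢ X 1 → y ≢ Z 2 → X 2 ≢ Z 0 → X 3 ≢ Z 1 →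
             Walk 3 4 u v 5
    walk-5 y ≢X₃ ≢Z₀ ≢X₁ ≢Z₂ X₂≢Z₀ X₃≢Z₁ = bridge⇒walk u v {k = 0} {λ _ → y} (s≤s z≤n) record
      { enters    = λ eq → ≢X₃ (sym eq)
      ; adjacent  = λ _ ()
      ; leaves    = ≢Z₀
      ; period-XY = λ { zero _ eq → ≢X₁ (sym eq) ; (suc _) () }
      ; period-XZ = λ { zero _ → X₂≢Z₀ ; (suc zero) _ → X₃≢Z₁ ; (suc (suc j)) (s≤s (s≤s (s≤s ()))) }
      ; period-YZ = λ { zero (suc (suc zero)) _ refl → ≢Z₂
                      ; zero zero _ () ; zero (suc zero) _ () ; zero (suc (suc (suc _))) _ ()
                      ; (suc _) _ () _ }
      }

    walk-6 : (y₀ y₁ : Letter) → Fresh (X 3) (X 1) (Z 1) y₀ → Fresh (Z 0) (X 2) (Z 2) y₁ → y₁ ≢ y₀ →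
             X 3 ≢ Z 0 → Walk 3 4 u v 6
    walk-6 y₀ y₁ (≢X₃ , ≢X₁ , ≢Z₁) (≢Z₀ , ≢X₂ , ≢Z₂) y₁≢y₀ X₃≢Z₀ = bridge⇒walk u v {k = 1} {Y} (s≤s (s≤s z≤n)) record
      { enters    = λ eq → ≢X₃ (sym eq)
      ; adjacent  = λ { zero _ eq → y₁≢y₀ (sym eq) ; (suc _) (s≤s ()) }
      ; leaves    = ≢Z₀
      ; period-XY = λ { zero _ eq → ≢X₁ (sym eq) ; (suc zero) _ eq → ≢X₂ (sym eq)
                      ; (suc (suc _)) (s≤s ()) }
      ; period-XZ = λ { zero _ → X₃≢Z₀ ; (suc j) (s≤s (s≤s (s≤s ()))) }
      ; period-YZ = λ { zero (suc zero) _ refl → ≢Z₁ ; (suc zero) (suc (suc zero)) _ refl → ≢Z₂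
                      ; zero zero _ () ; zero (suc (suc _)) _ ()
                      ; (suc zero) zero _ () ; (suc zero) (suc zero) _ () ; (suc zero) (suc (suc (suc _))) _ ()
                      ; (suc (suc _)) _ (s≤s ()) _ }
      }
      where
        Y : ℕ → Letter
        Y zero    = y₀
        Y (suc _) = y₁

    via-X₃≡Z₀ : X 3 ≡ Z 0 → DistLe 3 4 u v 6
    via-X₃≡Z₀ X₃≡Z₀ with fresh-letter (X 3) (X 1) (Z 2) ≤-refl
    ... | y , ≢X₃ , ≢X₁ , ≢Z₂ = _ , n≤1+n 5 ,
      walk-5 y ≢X₃ (λ eq → ≢X₃ (trans eq (sym X₃≡Z₀))) ≢X₁ ≢Z₂
        (λ eq → letters-adjacent u 2 (s≤s (s≤s (s≤s z≤n))) (trans eq (sym X₃≡Z₀)))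
        (λ eq → letters-adjacent v 0 (s≤s z≤n) (trans (sym X₃≡Z₀) eq))

    -- A two-letter bridge y₀ y₁ needs y₀ ∉ {X 3, X 1, Z 1}, y₁ ∉ {Z 0, X 2, Z 2} and y₁ ≠ y₀,
    -- which can be met when one of the two triples has a repetition.
    via-first-collision : Collision (X 3) (X 1) (Z 1) → X 3 ≢ Z 0 → DistLe 3 4 u v 6
    via-first-collision collision X₃≢Z₀ with fresh-letter (Z 0) (X 2) (Z 2) ≤-refl
    ... | y₁ , y₁-fresh with fresh-letter-beyond ≤-refl collision y₁
    ...   | y₀ , y₀-fresh , y₀≢y₁ = _ , ≤-refl , walk-6 y₀ y₁ y₀-fresh y₁-fresh (λ eq → y₀≢y₁ (sym eq)) X₃≢Z₀

    via-second-collision : Collision (Z 0) (X 2) (Z 2) → X 3 ≢ Z 0 → DistLe 3 4 u v 6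
    via-second-collision collision X₃≢Z₀ with fresh-letter (X 3) (X 1) (Z 1) ≤-refl
    ... | y₀ , y₀-fresh with fresh-letter-beyond ≤-refl collision y₀
    ...   | y₁ , y₁-fresh , y₁≢y₀ = _ , ≤-refl , walk-6 y₀ y₁ y₀-fresh y₁-fresh y₁≢y₀ X₃≢Z₀

    via-Z₁ : ¬ Collision (X 3) (X 1) (Z 1) → ¬ Collision (Z 0) (X 2) (Z 2) → DistLe 3 4 u v 6
    via-Z₁ distinct-X distinct-Z = _ , n≤1+n 5 ,
      walk-5 (Z 1) (λ eq → distinct-X (inj₂ (inj₁ (sym eq))))
                   (λ eq → letters-adjacent v 0 (s≤s z≤n) (sym eq))
                   (λ eq → distinct-X (inj₂ (inj₂ (sym eq))))
                   (letters-adjacent v 1 (s≤s (s≤s z≤n)))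
                   (λ eq → distinct-Z (inj₁ (sym eq)))
                   (λ eq → distinct-X (inj₂ (inj₁ eq)))

  dist≤6 : DistLe 3 4 u v 6
  dist≤6 with X 3 ≟ᶠ Z 0 | collision? ≤-refl (X 3) (X 1) (Z 1) | collision? ≤-refl (Z 0) (X 2) (Z 2)
  ... | yes X₃≡Z₀ | _              | _              = via-X₃≡Z₀ X₃≡Z₀
  ... | no X₃≢Z₀  | yes collision  | _              = via-first-collision collision X₃≢Z₀
  ... | no X₃≢Z₀  | no _           | yes collision  = via-second-collision collision X₃≢Z₀
  ... | no _      | no distinct-X  | no distinct-Z  = via-Z₁ distinct-X distinct-Z

-- Pairs of vertices far apart

module WalksBetween {d m : ℕ} (fx fz : ℕ → Fin (suc d))
             (ax : ∀ p → p < m → fx p ≢ fx (suc p)) (cx : fx 0 ≢ fx m)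
             (az : ∀ p → p < m → fz p ≢ fz (suc p)) (cz : fz 0 ≢ fz m) where
  open Words d m

  module _ {n : ℕ} (W : Walk d (suc m) (vertex fx ax cx) (vertex fz az cz) n) where
    open WalkWord (walk⇒walkWord W) using (isWalkWord; starts; ends)
    open IsWalkWord isWalkWord public
    open WalkWord (walk⇒walkWord W) using (word) public

    word-start : ∀ p → p ≤ m → word p ≡ fx p
    word-start p p≤m = trans (starts p p≤m) (letters-vertex fx ax cx p p≤m)

    word-end : ∀ c → c ≤ m → word (n + c) ≡ fz c
    word-end c c≤m = trans (ends c c≤m) (letters-vertex fz az cz c c≤m)

    coincide : ∀ p c → p ≤ m → c ≤ m → p ≡ n + c → fx p ≡ fz c
    coincide p c p≤m c≤m p≡n+c = trans (sym (word-start p p≤m)) (trans (cong word p≡n+c) (word-end c c≤m))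

    adjacent-apart : ∀ p c → p ≤ m → c ≤ m → p < n + m → suc p ≡ n + c → fx p ≢ fz c
    adjacent-apart p c p≤m c≤m p<n+m 1+p≡n+c eq =
      adjacent≢ p p<n+m (trans (word-start p p≤m) (trans eq (sym (trans (cong word 1+p≡n+c) (word-end c c≤m)))))

    period-apart : ∀ p c → p ≤ m → c ≤ m → p ≤ n → p + m ≡ n + c → fx p ≢ fz c
    period-apart p c p≤m c≤m p≤n p+m≡n+c eq =
      period≢ p p≤n (trans (word-start p p≤m) (trans eq (sym (trans (cong word p+m≡n+c) (word-end c c≤m)))))

module _ (d : ℕ) where
  open Words (2 + d) 2

  private
    fx fz : ℕ → Letter
    fx 0 = # 0
    fx 1 = # 1
    fx _ = # 2
    fz 0 = # 2
    fz 1 = # 1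
    fz _ = # 0

    fx-adjacent : ∀ p → p < 2 → fx p ≢ fx (suc p)
    fx-adjacent 0 _ ()
    fx-adjacent 1 _ ()
    fx-adjacent (suc (suc p)) (s≤s (s≤s ()))

    fz-adjacent : ∀ p → p < 2 → fz p ≢ fz (suc p)
    fz-adjacent 0 _ ()
    fz-adjacent 1 _ ()
    fz-adjacent (suc (suc p)) (s≤s (s≤s ()))

  u₃ v₃ : CKVertex (2 + d) 3
  u₃ = vertex fx fx-adjacent (λ ())
  v₃ = vertex fz fz-adjacent (λ ())

  open WalksBetween {m = 2} fx fz fx-adjacent (λ ()) fz-adjacent (λ ())

  u₃-v₃-far : ∀ n → Walk (2 + d) 3 u₃ v₃ n → 5 ≤ n
  u₃-v₃-far 0 W = contradiction (coincide W 0 0 z≤n z≤n refl) λ ()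
  u₃-v₃-far 1 W = contradiction (coincide W 1 0 (s≤s z≤n) z≤n refl) λ ()
  u₃-v₃-far 2 W = contradiction refl (period-apart W 1 1 (s≤s z≤n) (s≤s z≤n) (s≤s z≤n) refl)
  u₃-v₃-far 3 W = contradiction refl (adjacent-apart W 2 0 ≤-refl z≤n (s≤s (s≤s (s≤s z≤n))) refl)
  u₃-v₃-far 4 W = contradiction refl (period-apart W 2 0 ≤-refl z≤n (s≤s (s≤s z≤n)) refl)
  u₃-v₃-far (suc (suc (suc (suc (suc n))))) W = s≤s (s≤s (s≤s (s≤s (s≤s z≤n))))

module _ where
  open Words 3 3

  private
    fx fz : ℕ → Letter
    fx 0 = # 0
    fx 1 = # 1
    fx 2 = # 0
    fx _ = # 2
    fz 0 = # 1
    fz 1 = # 2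
    fz 2 = # 1
    fz _ = # 0

    fx-adjacent : ∀ p → p < 3 → fx p ≢ fx (suc p)
    fx-adjacent 0 _ ()
    fx-adjacent 1 _ ()
    fx-adjacent 2 _ ()
    fx-adjacent (suc (suc (suc p))) (s≤s (s≤s (s≤s ())))

    fz-adjacent : ∀ p → p < 3 → fz p ≢ fz (suc p)
    fz-adjacent 0 _ ()
    fz-adjacent 1 _ ()
    fz-adjacent 2 _ ()
    fz-adjacent (suc (suc (suc p))) (s≤s (s≤s (s≤s ())))

  u₄ v₄ : CKVertex 3 4
  u₄ = vertex fx fx-adjacent (λ ())
  v₄ = vertex fz fz-adjacent (λ ())

  open WalksBetween {m = 3} fx fz fx-adjacent (λ ()) fz-adjacent (λ ())

  u₄-v₄-far : ∀ n → Walk 3 4 u₄ v₄ n → 6 ≤ n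
  u₄-v₄-far 0 W = contradiction (coincide W 0 0 z≤n z≤n refl) λ ()
  u₄-v₄-far 1 W = contradiction (coincide W 2 1 (s≤s (s≤s z≤n)) (s≤s z≤n) refl) λ ()
  u₄-v₄-far 2 W = contradiction (coincide W 2 0 (s≤s (s≤s z≤n)) z≤n refl) λ ()
  u₄-v₄-far 3 W = contradiction (coincide W 3 0 ≤-refl z≤n refl) λ ()
  u₄-v₄-far 4 W = contradiction refl (period-apart W 1 0 (s≤s z≤n) z≤n (s≤s z≤n) refl)
  u₄-v₄-far 5 W = contradiction refl (period-apart W 3 1 ≤-refl (s≤s z≤n) (s≤s (s≤s (s≤s z≤n))) refl)
  u₄-v₄-far (suc (suc (suc (suc (suc (suc n)))))) W = s≤s (s≤s (s≤s (s≤s (s≤s (s≤s z≤n)))))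

patch : {A : Set} → ℕ → A → (ℕ → A) → ℕ → A
patch i a f p with p ≟ i
... | yes _ = a
... | no _  = f p

module _ {A : Set} (i : ℕ) (a : A) (f : ℕ → A) where

  patch-at : patch i a f i ≡ a
  patch-at with i ≟ i
  ... | yes _ = refl
  ... | no i≢i = ⊥-elim (i≢i refl)

  patch-off : ∀ p → p ≢ i → patch i a f p ≡ f p
  patch-off p p≢i with p ≟ i
  ... | yes p≡i = ⊥-elim (p≢i p≡i)
  ... | no _    = refl

alternate : {A : Set} → A → A → ℕ → A
alternate a b zero          = a
alternate a b (suc zero)    = b
alternate a b (suc (suc p)) = alternate a b p

module _ {A : Set} {a b : A} where

  alternate-pair : (P : A → A → Set) → P a b → P b a → ∀ p → P (alternate a b p) (alternate a b (suc p))
  alternate-pair P ab ba zero          = ab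
  alternate-pair P ab ba (suc zero)    = ba
  alternate-pair P ab ba (suc (suc p)) = alternate-pair P ab ba p

  alternate-skip : ∀ q p → alternate a b (q + q + p) ≡ alternate a b p
  alternate-skip zero    p = refl
  alternate-skip (suc q) p = trans (cong (λ r → alternate a b (suc r + p)) (+-suc q q)) (alternate-skip q p)

  alternate-even : ∀ j → alternate a b (j + j) ≡ a
  alternate-even j = trans (cong (alternate a b) (sym (+-identityʳ (j + j)))) (alternate-skip j 0)

  alternate-odd : ∀ j → alternate a b (suc (j + j)) ≡ b
  alternate-odd j = trans (cong (alternate a b) (+-comm 1 (j + j))) (alternate-skip j 1)

parity : ∀ t → ∃ λ j → t ≡ j + j ⊎ t ≡ suc (j + j)
parity zero = 0 , inj₁ refl
parity (suc t) with parity t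
... | j , inj₁ t≡2j   = j , inj₂ (cong suc t≡2j)
... | j , inj₂ t≡2j+1 = suc j , inj₁ (trans (cong suc t≡2j+1) (cong suc (sym (+-suc j j))))

Covers : (a b c e : Fin 4) → Set
Covers a b c e = ∀ y → y ≡ a ⊎ y ≡ b ⊎ y ≡ c ⊎ y ≡ e

module _ {a b c e : Fin 4} (covers : Covers a b c e) where

  remaining : ∀ {y} → y ≢ a → y ≢ b → y ≢ c → y ≡ e
  remaining {y} y≢a y≢b y≢c with covers y
  ... | inj₁ y≡a               = ⊥-elim (y≢a y≡a)
  ... | inj₂ (inj₁ y≡b)        = ⊥-elim (y≢b y≡b)
  ... | inj₂ (inj₂ (inj₁ y≡c)) = ⊥-elim (y≢c y≡c)
  ... | inj₂ (inj₂ (inj₂ y≡e)) = y≡e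

  uncovered : ∀ {y} → y ≢ a → y ≢ b → y ≢ c → y ≢ e → ⊥
  uncovered y≢a y≢b y≢c y≢e = y≢e (remaining y≢a y≢b y≢c)

  covers-swapˡ : Covers b a c e
  covers-swapˡ y with covers y
  ... | inj₁ y≡a        = inj₂ (inj₁ y≡a)
  ... | inj₂ (inj₁ y≡b) = inj₁ y≡b
  ... | inj₂ (inj₂ y∈)  = inj₂ (inj₂ y∈)

  covers-swapʳ : Covers a b e c
  covers-swapʳ y with covers y
  ... | inj₂ (inj₂ (inj₁ y≡c)) = inj₂ (inj₂ (inj₂ y≡c))
  ... | inj₂ (inj₂ (inj₂ y≡e)) = inj₂ (inj₂ (inj₁ y≡e))
  ... | inj₁ y≡a               = inj₁ y≡a
  ... | inj₂ (inj₁ y≡b)        = inj₂ (inj₁ y≡b)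

covers-alternations : ∀ {a b c e} → Covers a b c e → ∀ p i →
  Covers (alternate a b p) (alternate a b (suc p)) (alternate c e i) (alternate c e (suc i))
covers-alternations {a} {b} {c} {e} covers p i =
  alternate-pair (λ x y → Covers x y (alternate c e i) (alternate c e (suc i)))
    (on-right covers) (on-right (covers-swapˡ covers)) p
  where
    on-right : ∀ {x y} → Covers x y c e → Covers x y (alternate c e i) (alternate c e (suc i))
    on-right cov = alternate-pair (Covers _ _) cov (covers-swapʳ cov) i

covers-Fin4 : Covers (# 0) (# 1) (# 2) (# 3)
covers-Fin4 zero                   = inj₁ refl
covers-Fin4 (suc zero)             = inj₂ (inj₁ refl)
covers-Fin4 (suc (suc zero))       = inj₂ (inj₂ (inj₁ refl))
covers-Fin4 (suc (suc (suc zero))) = inj₂ (inj₂ (inj₂ refl))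

alt₀₁ alt₂₃ : ℕ → Fin 4
alt₀₁ = alternate (# 0) (# 1)
alt₂₃ = alternate (# 2) (# 3)

alt₀₁≢2 : ∀ p → alt₀₁ p ≢ # 2
alt₀₁≢2 = alternate-pair (λ x _ → x ≢ # 2) (λ ()) (λ ())

alt₀₁-adjacent : ∀ p → alt₀₁ p ≢ alt₀₁ (suc p)
alt₀₁-adjacent = alternate-pair _≢_ (λ ()) (λ ())

-- For ℓ = 2h + 1: u = (01)ʰ2 and v = 2(10)ʰ.
module _ (h′ : ℕ) where
  private
    h m : ℕ
    h = suc h′
    m = h + h
  open Words 3 m

  private
    fx fz : ℕ → Letter
    fx = patch m (# 2) alt₀₁
    fz = patch 0 (# 2) alt₀₁

    fx-below : ∀ p → p < m → fx p ≡ alt₀₁ p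
    fx-below p p<m = patch-off m (# 2) alt₀₁ p (<⇒≢ p<m)

    fx-top : fx m ≡ # 2
    fx-top = patch-at m (# 2) alt₀₁

    fx-adjacent : ∀ p → p < m → fx p ≢ fx (suc p)
    fx-adjacent p p<m with m≤n⇒m<n∨m≡n p<m
    ... | inj₁ 1+p<m = ≢-resp (fx-below p p<m) (fx-below (suc p) 1+p<m) (alt₀₁-adjacent p)
    ... | inj₂ 1+p≡m = ≢-resp (fx-below p p<m) (trans (cong fx 1+p≡m) fx-top) (alt₀₁≢2 p)

    fx-cyclic : fx 0 ≢ fx m
    fx-cyclic = ≢-resp (fx-below 0 (s≤s z≤n)) fx-top (λ ())

    fz-adjacent : ∀ p → p < m → fz p ≢ fz (suc p)
    fz-adjacent zero    _ ()
    fz-adjacent (suc p) _ = alt₀₁-adjacent (suc p)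

    fz-cyclic : fz 0 ≢ fz m
    fz-cyclic eq = alt₀₁≢2 m (sym eq)

  u-odd v-odd : CKVertex 3 (suc m)
  u-odd = vertex fx fx-adjacent fx-cyclic
  v-odd = vertex fz fz-adjacent fz-cyclic

  open WalksBetween {m = m} fx fz fx-adjacent fx-cyclic fz-adjacent fz-cyclic

  private
    fz-positive : ∀ c → 0 < c → fz c ≡ alt₀₁ c
    fz-positive (suc c) _ = refl

    module MediumWalk (t : ℕ) (t≤m : t ≤ m) (W : Walk 3 (suc m) u-odd v-odd (m + t)) where
      n : ℕ
      n = m + t

      even-excess-below-m : ∀ j → t ≡ j + j → j < h → ⊥
      even-excess-below-m j t≡2j j<h =
        period-apart W (suc t) 1 (<⇒≤ 1+t<m) (s≤s z≤n) (+-monoˡ-≤ t (s≤s z≤n)) (shift m t)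
          (trans (fx-below (suc t) 1+t<m) (trans (cong (λ r → alt₀₁ (suc r)) t≡2j) (alternate-odd j)))
        where
          1+t<m : suc t < m
          1+t<m = subst (λ r → suc r < m) (sym t≡2j) (subst (_≤ m) (cong suc (+-suc j j)) (+-mono-≤ j<h j<h))
          shift : ∀ a b → suc b + a ≡ a + b + 1
          shift = solve-∀

      excess-m : t ≡ m → ⊥
      excess-m t≡m = period-apart W m 0 ≤-refl z≤n (m≤m+n m t)
                     (trans (cong (m +_) (sym t≡m)) (sym (+-identityʳ n))) fx-top

      module OddExcess (j q : ℕ) (t≡2j+1 : t ≡ suc (j + j)) (h≡ : h ≡ suc j + q) where
        S : ℕ → Letter
        S = word W

        -- Each letter after u is squeezed between two consecutive letters of 0101… and its
        -- predecessor, so the word continues 2323…; the last of these letters clashes with v.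
        forced : ∀ i → i < t → S (m + i) ≡ alt₂₃ i
        forced zero _ = trans (cong S (+-identityʳ m)) (trans (word-start W m ≤-refl) fx-top)
        forced (suc i) 1+i<t =
          remaining (covers-alternations covers-Fin4 i i) ≢alt₀₁ ≢alt₀₁′ ≢alt₂₃
          where
            1+i<m : suc i < m
            1+i<m = <-≤-trans 1+i<t t≤m
            ≢alt₀₁′ : S (m + suc i) ≢ alt₀₁ (suc i)
            ≢alt₀₁′ eq = period≢ W (suc i) (≤-trans (<⇒≤ 1+i<t) (m≤n+m t m))
              (trans (word-start W (suc i) (<⇒≤ 1+i<m))
                (trans (fx-below (suc i) 1+i<m) (trans (sym eq) (cong S (+-comm m (suc i))))))
            c : ℕ
            c = q + q + suc (suc i)
            c≤m : c ≤ m
            c≤m = subst (c ≤_) (sym m≡) (+-monoʳ-≤ (q + q) (s≤s (s≤s (<⇒≤ (≤-pred (subst (suc i <_) t≡2j+1 1+i<t))))))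
              where
                m≡ : m ≡ q + q + suc (suc (j + j))
                m≡ = trans (cong (λ r → r + r) h≡) (rearrange j q)
                  where
                    rearrange : ∀ a b → suc a + b + (suc a + b) ≡ b + b + suc (suc (a + a))
                    rearrange = solve-∀
            position : m + suc i + m ≡ n + c
            position = trans (cong (λ r → m + suc i + (r + r)) h≡)
                         (trans (rearrange m i j q) (cong (λ r → m + r + c) (sym t≡2j+1)))
              where
                rearrange : ∀ M a b e → M + suc a + (suc b + e + (suc b + e)) ≡ M + suc (b + b) + (e + e + suc (suc a))
                rearrange = solve-∀
            ≢alt₀₁ : S (m + suc i) ≢ alt₀₁ i
            ≢alt₀₁ eq = period≢ W (m + suc i) (+-monoʳ-≤ m (<⇒≤ 1+i<t))
              (trans eq (sym (trans (cong S position) (trans (word-end W c c≤m)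
                (trans (fz-positive c (≤-trans (s≤s z≤n) (m≤n+m (suc (suc i)) (q + q)))) (alternate-skip q (suc (suc i))))))))
            ≢alt₂₃ : S (m + suc i) ≢ alt₂₃ i
            ≢alt₂₃ eq = adjacent≢ W (m + i) (≤-trans (+-monoʳ-< m (≤-trans (n≤1+n _) 1+i<t)) (m≤m+n n m))
              (trans (forced i (≤-trans (n≤1+n _) 1+i<t)) (trans (sym eq) (cong S (+-suc m i))))

        contradiction-at-end : ⊥
        contradiction-at-end = adjacent≢ W (m + (j + j)) (≤-trans (+-monoʳ-< m 2j<t) (m≤m+n n m))
          (trans (forced (j + j) 2j<t) (trans (alternate-even j)
            (sym (trans (cong S (trans (sym (+-suc m (j + j))) (trans (cong (m +_) (sym t≡2j+1)) (sym (+-identityʳ n)))))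
                   (word-end W 0 z≤n)))))
          where
            2j<t : j + j < t
            2j<t = subst (j + j <_) (sym t≡2j+1) ≤-refl

      impossible : ⊥
      impossible with parity t
      ... | j , inj₁ t≡2j with j <? h
      ...   | yes j<h = even-excess-below-m j t≡2j j<h
      ...   | no j≮h  = excess-m (≤-antisym t≤m (subst (m ≤_) (sym t≡2j) (+-mono-≤ (≮⇒≥ j≮h) (≮⇒≥ j≮h))))
      impossible | j , inj₂ t≡2j+1 = OddExcess.contradiction-at-end j (h ∸ suc j) t≡2j+1 (sym (m+[n∸m]≡n j<h))
        where
          j<h : j < h
          j<h with j <? h
          ... | yes j<h = j<h
          ... | no j≮h = ⊥-elim (<⇒≱ (s≤s (+-mono-≤ (≮⇒≥ j≮h) (≮⇒≥ j≮h))) (subst (_≤ m) t≡2j+1 t≤m))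

  odd-pair-far : ∀ n → Walk 3 (suc m) u-odd v-odd n → suc (m + m) ≤ n
  odd-pair-far n W with m + m <? n
  ... | yes long = long
  ... | no ¬long with n <? m
  ...   | yes n<m = ⊥-elim (alt₀₁≢2 n (trans (sym (fx-below n n<m))
                      (coincide W n 0 (<⇒≤ n<m) z≤n (sym (+-identityʳ n)))))
  ...   | no n≮m = ⊥-elim (MediumWalk.impossible (n ∸ m) t≤m (subst (Walk 3 (suc m) u-odd v-odd) (sym m+t≡n) W))
    where
      m+t≡n : m + (n ∸ m) ≡ n
      m+t≡n = m+[n∸m]≡n (≮⇒≥ n≮m)
      t≤m : n ∸ m ≤ m
      t≤m = +-cancelˡ-≤ m _ _ (subst (_≤ m + m) (sym m+t≡n) (≮⇒≥ ¬long))

alt₀₂ alt₃₁ : ℕ → Fin 4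
alt₀₂ = alternate (# 0) (# 2)
alt₃₁ = alternate (# 3) (# 1)

alt₀₂≢1 : ∀ p → alt₀₂ p ≢ # 1
alt₀₂≢1 = alternate-pair (λ x _ → x ≢ # 1) (λ ()) (λ ())

alt₀₂-adjacent : ∀ p → alt₀₂ p ≢ alt₀₂ (suc p)
alt₀₂-adjacent = alternate-pair _≢_ (λ ()) (λ ())

covers-0231 : Covers (# 0) (# 2) (# 3) (# 1)
covers-0231 zero                   = inj₁ refl
covers-0231 (suc zero)             = inj₂ (inj₂ (inj₂ refl))
covers-0231 (suc (suc zero))       = inj₂ (inj₁ refl)
covers-0231 (suc (suc (suc zero))) = inj₂ (inj₂ (inj₁ refl))


-- For ℓ = 2q + 6: u = 01(02)^q 0312 and v = 21(02)^(q+1) 01.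
module _ (q : ℕ) where
  private
    M₂ M₁ m : ℕ
    M₂ = 3 + (q + q)
    M₁ = suc M₂
    m  = suc M₁
  open Words 3 m

  private
    fx fx′ fx″ fz fz′ fz″ : ℕ → Letter
    fx″ = patch M₁ (# 1) alt₀₂
    fx′ = patch M₂ (# 3) fx″
    fx  = patch 1 (# 1) fx′
    fz″ = patch m (# 1) alt₀₂
    fz′ = patch 1 (# 1) fz″
    fz  = patch 0 (# 2) fz′

    fx-generic : ∀ p → p ≢ 1 → p ≢ M₂ → p ≢ M₁ → fx p ≡ alt₀₂ p
    fx-generic p p≢1 p≢M₂ p≢M₁ =
      trans (patch-off 1 (# 1) fx′ p p≢1) (trans (patch-off M₂ (# 3) fx″ p p≢M₂) (patch-off M₁ (# 1) alt₀₂ p p≢M₁))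

    fx-M₂ : fx M₂ ≡ # 3
    fx-M₂ = trans (patch-off 1 (# 1) fx′ M₂ (λ ())) (patch-at M₂ (# 3) fx″)

    fx-M₁ : fx M₁ ≡ # 1
    fx-M₁ = trans (patch-off 1 (# 1) fx′ M₁ (λ ())) (trans (patch-off M₂ (# 3) fx″ M₁ (λ eq → <-irrefl (sym eq) ≤-refl))
              (patch-at M₁ (# 1) alt₀₂))

    fx-m : fx m ≡ # 2
    fx-m = trans (fx-generic m (λ ()) (λ eq → <-irrefl (sym eq) (n≤1+n M₁)) (λ eq → <-irrefl (sym eq) ≤-refl))
             (alternate-odd q)

    fz-generic : ∀ p → p ≢ 0 → p ≢ 1 → p ≢ m → fz p ≡ alt₀₂ p
    fz-generic p p≢0 p≢1 p≢m =
      trans (patch-off 0 (# 2) fz′ p p≢0) (trans (patch-off 1 (# 1) fz″ p p≢1) (patch-off m (# 1) alt₀₂ p p≢m))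

    fz-m : fz m ≡ # 1
    fz-m = trans (patch-off 0 (# 2) fz′ m (λ ())) (trans (patch-off 1 (# 1) fz″ m (λ ())) (patch-at m (# 1) alt₀₂))

    fx-adjacent : ∀ p → p < m → fx p ≢ fx (suc p)
    fx-adjacent 0 _ = λ ()
    fx-adjacent 1 _ = λ ()
    fx-adjacent p@(suc (suc _)) p<m = by-position (suc p ≟ M₂) (p ≟ M₂) (p ≟ M₁)
      where
        by-position : Dec (suc p ≡ M₂) → Dec (p ≡ M₂) → Dec (p ≡ M₁) → fx p ≢ fx (suc p)
        by-position (yes 1+p≡M₂) _ _ =
          ≢-resp (fx-generic p (λ ()) (<⇒≢ (subst (p <_) 1+p≡M₂ ≤-refl))
                                    (<⇒≢ (subst (p <_) (cong suc 1+p≡M₂) (n≤1+n _))))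
                 (trans (cong fx 1+p≡M₂) fx-M₂) (alternate-pair (λ x _ → x ≢ # 3) (λ ()) (λ ()) p)
        by-position (no _) (yes p≡M₂) _ =
          ≢-resp (trans (cong fx p≡M₂) fx-M₂) (trans (cong (fx ∘ suc) p≡M₂) fx-M₁) (λ ())
        by-position (no _) (no _) (yes p≡M₁) =
          ≢-resp (trans (cong fx p≡M₁) fx-M₁) (trans (cong (fx ∘ suc) p≡M₁) fx-m) (λ ())
        by-position (no 1+p≢M₂) (no p≢M₂) (no p≢M₁) =
          ≢-resp (fx-generic p (λ ()) p≢M₂ p≢M₁)
                 (fx-generic (suc p) (λ ()) 1+p≢M₂ (λ eq → p≢M₂ (suc-injective eq)))
                 (alt₀₂-adjacent p)

    fx-cyclic : fx 0 ≢ fx m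
    fx-cyclic = ≢-resp refl fx-m (λ ())

    fz-adjacent : ∀ p → p < m → fz p ≢ fz (suc p)
    fz-adjacent 0 _ = λ ()
    fz-adjacent 1 _ = λ ()
    fz-adjacent p@(suc (suc _)) p<m = by-position (suc p ≟ m)
      where
        by-position : Dec (suc p ≡ m) → fz p ≢ fz (suc p)
        by-position (yes 1+p≡m) =
          ≢-resp (fz-generic p (λ ()) (λ ()) (<⇒≢ p<m)) (trans (cong fz 1+p≡m) fz-m) (alt₀₂≢1 p)
        by-position (no 1+p≢m) =
          ≢-resp (fz-generic p (λ ()) (λ ()) (<⇒≢ p<m)) (fz-generic (suc p) (λ ()) (λ ()) 1+p≢m)
                 (alt₀₂-adjacent p)

    fz-cyclic : fz 0 ≢ fz m
    fz-cyclic = ≢-resp refl fz-m (λ ())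

  u-even v-even : CKVertex 3 (suc m)
  u-even = vertex fx fx-adjacent fx-cyclic
  v-even = vertex fz fz-adjacent fz-cyclic

  open WalksBetween {m = m} fx fz fx-adjacent fx-cyclic fz-adjacent fz-cyclic

  private
    Walk′ : ℕ → Set
    Walk′ = Walk 3 (suc m) u-even v-even

    M₂≢ : ∀ {p} → p < M₂ → p ≢ M₂ × p ≢ M₁
    M₂≢ p<M₂ = <⇒≢ p<M₂ , <⇒≢ (≤-trans p<M₂ (n≤1+n M₂))

    below-M₂ : ∀ {p} → p < M₂ → p ≤ m
    below-M₂ p<M₂ = ≤-trans (<⇒≤ p<M₂) (≤-trans (n≤1+n M₂) (n≤1+n M₁))

    m≤length : ∀ k → m ≤ suc m + k
    m≤length k = ≤-trans (n≤1+n m) (m≤m+n (suc m) k)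

    no-bridge-0 : Walk′ (suc m + 0) → ⊥
    no-bridge-0 W = adjacent-apart W m 0 ≤-refl z≤n
                      (≤-trans (m≤m+n (suc m) m) (≤-reflexive (cong (_+ m) (sym (+-identityʳ (suc m))))))
                      (sym (trans (+-identityʳ (suc m + 0)) (+-identityʳ (suc m)))) fx-m

    no-bridge-even : ∀ j → 1 ≤ j → j ≤ q → Walk′ (suc m + (j + j)) → ⊥
    no-bridge-even j@(suc _) _ j≤q W =
      period-apart W (suc (j + j)) 0 (below-M₂ p<M₂) z≤n (≤-trans (below-M₂ p<M₂) (m≤length _))
        (position j q)
        (trans (fx-generic (suc (j + j)) (λ eq → ≢0 (suc-injective eq)) (proj₁ (M₂≢ p<M₂)) (proj₂ (M₂≢ p<M₂)))
               (alternate-odd j))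
      where
        p<M₂ : suc (j + j) < M₂
        p<M₂ = s≤s (s≤s (≤-trans (+-mono-≤ j≤q j≤q) (n≤1+n _)))
        ≢0 : j + j ≢ 0
        ≢0 ()
        position : ∀ a b → suc (a + a) + suc (suc (suc (suc (suc (b + b))))) ≡
                           suc (suc (suc (suc (suc (suc (b + b)))))) + (a + a) + 0
        position = solve-∀

    no-bridge-2q+2 : Walk′ (suc m + (suc q + suc q)) → ⊥
    no-bridge-2q+2 W =
      period-apart W M₁ 1 (n≤1+n M₁) (s≤s z≤n) (≤-trans (n≤1+n M₁) (m≤length _)) (position q) fx-M₁
      where
        position : ∀ a → suc (suc (suc (suc (a + a)))) + suc (suc (suc (suc (suc (a + a))))) ≡
                         suc (suc (suc (suc (suc (suc (a + a)))))) + (suc a + suc a) + 1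
        position = solve-∀

    no-bridge-2q+4 : Walk′ (suc m + (suc (suc q) + suc (suc q))) → ⊥
    no-bridge-2q+4 W = period-apart W m 0 ≤-refl z≤n (m≤length _) (position q) fx-m
      where
        position : ∀ a → suc (suc (suc (suc (suc (a + a))))) + suc (suc (suc (suc (suc (a + a))))) ≡
                         suc (suc (suc (suc (suc (suc (a + a)))))) + (suc (suc a) + suc (suc a)) + 0
        position = solve-∀

    no-bridge-odd : ∀ j → j < q → Walk′ (suc m + suc (j + j)) → ⊥
    no-bridge-odd j j<q W =
      period-apart W (4 + (j + j)) 2 (below-M₂ p<M₂) (s≤s (s≤s z≤n)) (≤-trans (below-M₂ p<M₂) (m≤length _))
        (position j q)
        (trans (fx-generic (4 + (j + j)) (λ ()) (proj₁ (M₂≢ p<M₂)) (proj₂ (M₂≢ p<M₂))) (alternate-even j))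
      where
        p<M₂ : 4 + (j + j) < M₂
        p<M₂ = s≤s (s≤s (s≤s (subst (_≤ q + q) (cong suc (+-suc j j)) (+-mono-≤ j<q j<q))))
        position : ∀ a b → 4 + (a + a) + suc (suc (suc (suc (suc (b + b))))) ≡
                           suc (suc (suc (suc (suc (suc (b + b)))))) + suc (a + a) + 2
        position = solve-∀

    no-bridge-2q+1 : Walk′ (suc m + suc (q + q)) → ⊥
    no-bridge-2q+1 W = period-apart W m 3 ≤-refl (s≤s (s≤s (s≤s z≤n))) (m≤length _) (position q) fx-m
      where
        position : ∀ a → suc (suc (suc (suc (suc (a + a))))) + suc (suc (suc (suc (suc (a + a))))) ≡
                         suc (suc (suc (suc (suc (suc (a + a)))))) + suc (a + a) + 3
        position = solve-∀

    module Forced (W : Walk′ (suc m + M₂)) where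
      n : ℕ
      n = suc m + M₂

      S : ℕ → Letter
      S = word W

      ≤⇒<+m : ∀ {p} → p ≤ n → p < n + m
      ≤⇒<+m {p} p≤n = ≤-trans (s≤s p≤n) (subst (_≤ n + m) (+-comm n 1) (+-monoʳ-≤ n (s≤s z≤n)))

      middle≤n : ∀ {t} → t ≤ M₂ → suc m + t ≤ n
      middle≤n t≤M₂ = +-monoʳ-≤ (suc m) t≤M₂

      first-middle : S (suc m + 0) ≡ S (suc m)
      first-middle = cong S (+-identityʳ (suc m))

      -- The bridge letters are forced to be 3131…, and then no letter is left for the next one.
      forced : ∀ t → t ≤ suc (q + q) → S (suc m + t) ≡ alt₃₁ t
      forced zero _ = remaining covers-Fin4 ≢0 ≢1 ≢2
        where
          ≢0 : S (suc m + 0) ≢ # 0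
          ≢0 eq = period≢ W (suc m) (m≤m+n (suc m) M₂)
            (trans (sym first-middle) (trans eq (sym (trans (cong S (position q)) (word-end W 2 (s≤s (s≤s z≤n)))))))
            where
              position : ∀ a → suc (suc (suc (suc (suc (suc (a + a)))))) + suc (suc (suc (suc (suc (a + a))))) ≡
                               suc (suc (suc (suc (suc (suc (a + a)))))) + suc (suc (suc (a + a))) + 2
              position = solve-∀
          ≢1 : S (suc m + 0) ≢ # 1
          ≢1 eq = period≢ W 1 (s≤s z≤n) (trans (word-start W 1 (s≤s z≤n)) (sym (trans (sym first-middle) eq)))
          ≢2 : S (suc m + 0) ≢ # 2
          ≢2 eq = adjacent≢ W m (≤⇒<+m (m≤length M₂))
            (trans (word-start W m ≤-refl) (trans fx-m (sym (trans (sym first-middle) eq))))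
      forced (suc t) 1+t≤ = remaining (covers-alternations covers-0231 t t) ≢alt₀₂ ≢alt₀₂′ ≢alt₃₁
        where
          t≤2q : t ≤ q + q
          t≤2q = ≤-pred 1+t≤
          2+t<M₂ : 2 + t < M₂
          2+t<M₂ = s≤s (s≤s (s≤s t≤2q))
          ≢alt₀₂ : S (suc m + suc t) ≢ alt₀₂ t
          ≢alt₀₂ eq = period≢ W (2 + t) (≤-trans (below-M₂ 2+t<M₂) (m≤length M₂))
            (trans (word-start W (2 + t) (below-M₂ 2+t<M₂))
              (trans (fx-generic (2 + t) (λ ()) (proj₁ (M₂≢ 2+t<M₂)) (proj₂ (M₂≢ 2+t<M₂)))
                (sym (trans (cong S (position t q)) eq))))
            where
              position : ∀ a b → suc (suc a) + suc (suc (suc (suc (suc (b + b))))) ≡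
                                 suc (suc (suc (suc (suc (suc (b + b)))))) + suc a
              position = solve-∀
          3+t<m : 3 + t < m
          3+t<m = s≤s (s≤s (s≤s (s≤s (≤-trans t≤2q (n≤1+n _)))))
          ≢alt₀₂′ : S (suc m + suc t) ≢ alt₀₂ (suc t)
          ≢alt₀₂′ eq = period≢ W (suc m + suc t) (middle≤n (≤-trans 1+t≤ (≤-trans (n≤1+n _) (n≤1+n _))))
            (trans eq (sym (trans (cong S (position t q))
              (trans (word-end W (3 + t) (<⇒≤ 3+t<m)) (fz-generic (3 + t) (λ ()) (λ ()) (<⇒≢ 3+t<m))))))
            where
              position : ∀ a b → suc (suc (suc (suc (suc (suc (b + b)))))) + suc a + suc (suc (suc (suc (suc (b + b))))) ≡
                                 suc (suc (suc (suc (suc (suc (b + b)))))) + suc (suc (suc (b + b))) + suc (suc (suc a))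
              position = solve-∀
          ≢alt₃₁ : S (suc m + suc t) ≢ alt₃₁ t
          ≢alt₃₁ eq = adjacent≢ W (suc m + t) (≤⇒<+m (middle≤n (≤-trans (n≤1+n t) (≤-trans 1+t≤ (≤-trans (n≤1+n _) (n≤1+n _))))))
            (trans (forced t (≤-trans (n≤1+n t) 1+t≤)) (trans (sym eq) (cong S (+-suc (suc m) t))))

      impossible : ⊥
      impossible = uncovered covers-Fin4 ≢0 ≢1 ≢2 ≢3
        where
          t : ℕ
          t = suc (suc (q + q))
          ≢3 : S (suc m + t) ≢ # 3
          ≢3 eq = period≢ W M₂ (≤-trans (n≤1+n M₂) (≤-trans (n≤1+n M₁) (m≤length M₂)))
            (trans (word-start W M₂ (≤-trans (n≤1+n M₂) (n≤1+n M₁))) (trans fx-M₂ (sym (trans (cong S (position q)) eq))))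
            where
              position : ∀ a → suc (suc (suc (a + a))) + suc (suc (suc (suc (suc (a + a))))) ≡
                               suc (suc (suc (suc (suc (suc (a + a)))))) + suc (suc (a + a))
              position = solve-∀
          ≢0 : S (suc m + t) ≢ # 0
          ≢0 eq = period≢ W (suc m + t) (middle≤n (n≤1+n t))
            (trans eq (sym (trans (cong S (position q))
              (trans (word-end W M₁ (n≤1+n M₁))
                (trans (fz-generic M₁ (λ ()) (λ ()) (<⇒≢ ≤-refl)) (alternate-even q))))))
            where
              position : ∀ a → suc (suc (suc (suc (suc (suc (a + a)))))) + suc (suc (a + a)) + suc (suc (suc (suc (suc (a + a))))) ≡
                               suc (suc (suc (suc (suc (suc (a + a)))))) + suc (suc (suc (a + a))) + suc (suc (suc (suc (a + a))))
              position = solve-∀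
          ≢1 : S (suc m + t) ≢ # 1
          ≢1 eq = adjacent≢ W (suc m + suc (q + q)) (≤⇒<+m (middle≤n (≤-trans (n≤1+n _) (n≤1+n _))))
            (trans (forced (suc (q + q)) ≤-refl) (trans (alternate-odd q) (trans (sym eq) (cong S (+-suc (suc m) (suc (q + q)))))))
          ≢2 : S (suc m + t) ≢ # 2
          ≢2 eq = adjacent≢ W (suc m + t) (≤⇒<+m (middle≤n (n≤1+n t)))
            (trans eq (sym (trans (cong S (position q)) (word-end W 0 z≤n))))
            where
              position : ∀ a → suc (suc (suc (suc (suc (suc (suc (a + a))))))) + suc (suc (a + a)) ≡
                               suc (suc (suc (suc (suc (suc (a + a)))))) + suc (suc (suc (a + a))) + 0
              position = solve-∀

    no-bridge-even-length : ∀ j → j ≤ suc (suc q) → Walk′ (suc m + (j + j)) → ⊥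
    no-bridge-even-length zero _ = no-bridge-0
    no-bridge-even-length (suc j) 1+j≤q+2 with m≤n⇒m<n∨m≡n 1+j≤q+2
    ... | inj₂ refl = no-bridge-2q+4
    ... | inj₁ (s≤s 1+j≤q+1) with m≤n⇒m<n∨m≡n 1+j≤q+1
    ...   | inj₂ refl = no-bridge-2q+2
    ...   | inj₁ (s≤s 1+j≤q) = no-bridge-even (suc j) (s≤s z≤n) 1+j≤q

    no-bridge-odd-length : ∀ j → j ≤ suc q → Walk′ (suc m + suc (j + j)) → ⊥
    no-bridge-odd-length j j≤q+1 with m≤n⇒m<n∨m≡n j≤q+1
    ... | inj₂ refl = Forced.impossible ∘ subst Walk′ (cong (λ r → suc m + suc (suc r)) (+-suc q q))
    ... | inj₁ (s≤s j≤q) with m≤n⇒m<n∨m≡n j≤q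
    ...   | inj₂ refl = no-bridge-2q+1
    ...   | inj₁ j<q = no-bridge-odd j j<q

    no-bridge : ∀ k → k ≤ M₁ → Walk′ (suc m + k) → ⊥
    no-bridge k k≤M₁ with parity k
    ... | j , inj₁ refl = no-bridge-even-length j
          (≮⇒≥ λ q+2<j → <⇒≱ (+-mono-< q+2<j q+2<j) (subst (j + j ≤_) (double q) k≤M₁))
      where
        double : ∀ a → suc (suc (suc (suc (a + a)))) ≡ suc (suc a) + suc (suc a)
        double = solve-∀
    ... | j , inj₂ refl = no-bridge-odd-length j
          (≤-pred (≰⇒> λ q+2≤j → <⇒≱ (subst (suc (j + j) ≤_) (double q) k≤M₁) (+-mono-≤ q+2≤j q+2≤j)))
      where
        double : ∀ a → suc (suc (suc (suc (a + a)))) ≡ suc (suc a) + suc (suc a)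
        double = solve-∀

    no-walk-m : Walk′ m → ⊥
    no-walk-m W = period-apart W 1 1 (s≤s z≤n) (s≤s z≤n) (s≤s z≤n) (+-comm 1 m) refl

    no-21-in-u : ∀ p → p < m → fx p ≡ # 2 → fx (suc p) ≡ # 1 → ⊥
    no-21-in-u zero _ ()
    no-21-in-u p@(suc _) p<m = by-position (suc p ≟ M₂) (p ≟ M₂)
      where
        by-position : Dec (suc p ≡ M₂) → Dec (p ≡ M₂) → fx p ≡ # 2 → fx (suc p) ≡ # 1 → ⊥
        by-position (yes 1+p≡M₂) _ _ eq = contradiction (trans (sym fx-M₂) (trans (cong fx (sym 1+p≡M₂)) eq)) λ ()
        by-position (no _) (yes p≡M₂) eq _ = contradiction (trans (sym fx-M₂) (trans (cong fx (sym p≡M₂)) eq)) λ ()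
        by-position (no 1+p≢M₂) (no p≢M₂) _ eq =
          alt₀₂≢1 (suc p) (trans (sym (fx-generic (suc p) (λ ()) 1+p≢M₂ (λ eq′ → p≢M₂ (suc-injective eq′)))) eq)

  even-pair-far : ∀ n → Walk 3 (suc m) u-even v-even n → suc (m + m) ≤ n
  even-pair-far n W with m + m <? n
  ... | yes long = long
  ... | no ¬long with <-cmp n m
  ...   | tri< n<m _ _ = ⊥-elim (no-21-in-u n n<m
                           (coincide W n 0 (<⇒≤ n<m) z≤n (sym (+-identityʳ n)))
                           (coincide W (suc n) 1 n<m (s≤s z≤n) (+-comm 1 n)))
  ...   | tri≈ _ refl _ = ⊥-elim (no-walk-m W)
  ...   | tri> _ _ m<n = ⊥-elim (no-bridge (n ∸ suc m) k≤M₁ (subst Walk′ (sym m+k≡n) W))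
    where
      m+k≡n : suc m + (n ∸ suc m) ≡ n
      m+k≡n = m+[n∸m]≡n m<n
      k≤M₁ : n ∸ suc m ≤ M₁
      k≤M₁ = ≤-pred (+-cancelˡ-≤ m (suc (n ∸ suc m)) m
               (subst (_≤ m + m) (trans (sym m+k≡n) (sym (+-suc m (n ∸ suc m)))) (≮⇒≥ ¬long)))

2*ℓ∸1 : ∀ m → 2 * suc m ∸ 1 ≡ suc (m + m)
2*ℓ∸1 m = identity m
  where
    identity : ∀ a → a + (suc a + 0) ≡ suc (a + a)
    identity = solve-∀

FarApart : (d ℓ D : ℕ) → Set
FarApart d ℓ D = ∃ λ (u : CKVertex d ℓ) → ∃ λ (v : CKVertex d ℓ) → ∀ n → Walk d ℓ u v n → D ≤ n

far-apart-3 : ∀ d → 3 ≤ d → FarApart d 3 (2 * 3 ∸ 1)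
far-apart-3 (suc (suc d′)) (s≤s (s≤s _)) = u₃ d′ , v₃ d′ , u₃-v₃-far d′

far-apart-4 : FarApart 3 4 6
far-apart-4 = u₄ , v₄ , u₄-v₄-far

far-apart : ∀ ℓ → 3 ≤ ℓ → ℓ ≢ 4 → FarApart 3 ℓ (2 * ℓ ∸ 1)
far-apart ℓ 3≤ℓ ℓ≢4 with parity ℓ
... | zero , inj₂ refl = ⊥-elim (<⇒≱ 3≤ℓ (s≤s z≤n))
... | suc h′ , inj₂ refl =
  u-odd h′ , v-odd h′ , λ n W → subst (_≤ n) (sym (2*ℓ∸1 (suc h′ + suc h′))) (odd-pair-far h′ n W)
... | zero , inj₁ refl = ⊥-elim (<⇒≱ 3≤ℓ z≤n)
... | suc zero , inj₁ refl = ⊥-elim (<⇒≱ 3≤ℓ (s≤s (s≤s z≤n)))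
... | suc (suc zero) , inj₁ refl = ⊥-elim (ℓ≢4 refl)
... | suc (suc (suc q)) , inj₁ refl = subst (λ ℓ′ → FarApart 3 ℓ′ (2 * ℓ′ ∸ 1)) (ℓ≡ q)
  (u-even q , v-even q , λ n W → subst (_≤ n) (sym (2*ℓ∸1 (5 + (q + q)))) (even-pair-far q n W))
  where
    ℓ≡ : ∀ a → suc (suc (suc (suc (suc (suc (a + a)))))) ≡ suc (suc (suc a)) + suc (suc (suc a))
    ℓ≡ = solve-∀

mainTheorem6 : ((∀ (ℓ : ℕ) → 3 ≤ ℓ → ℓ ≢ 4 → HasDiameter 3 ℓ (2 * ℓ ∸ 1)) ×
    (∀ (d : ℕ) → 3 ≤ d → HasDiameter d 3 (2 * 3 ∸ 1))) ×
    HasDiameter 3 4 6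
mainTheorem6 =
  ( (λ ℓ 3≤ℓ ℓ≢4 → all-dist≤2ℓ∸1 ℓ ≤-refl 3≤ℓ , far-apart ℓ 3≤ℓ ℓ≢4)
  , (λ d 3≤d → all-dist≤2ℓ∸1 3 3≤d ≤-refl , far-apart-3 d 3≤d) )
  , dist≤6 , far-apart-4
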